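{- There are natural isomorphisms of combinatorial species $\mathrm{Ens}(D_3)\simeq D_3^*\simeq S_2\times S_3$.
   Context: A combinatorial species is a functor from the category of finite sets with bijections to the category of finite sets. For a species $F$ with $F(\emptyset)=\emptyset$, $\mathrm{Ens}(F)$ is the species whose structures on a finite set $E$ are set partitions $\{P_1,\dots,P_n\}$ of $E$ together with an $F$-structure on each block. The cartesian product $F\times G$ is given by $(F\times G)(E)=F(E)\times G(E)$. $S_n$ denotes the species of permutations $\sigma$ with $\sigma^n=\mathrm{id}$, transported by conjugation ($S_2$: involutions, $S_3$: permutations of order dividing three). A diagram with arc set $E$ consists of a set $\Gamma_0$ of vertices, maps $s,t:E\to\Gamma_0$, an involution $a\mapsto a^{ -1}$ of $E$ with $s(a^{ -1})=t(a)$, $t(a^{ -1})=s(a)$, and an action $(a,k)\mapsto a+k$ of $\mathbb{Z}$ on $E$ whose orbits are exactly the stars $s^{ -1}(x)$, with no isolated vertex (considered up to isomorphisms that are the identity on arcs). It is trivalent if every star has one or three elements, and connected if any two distinct vertices are joined by a chain of arcs $a_0,\dots,a_n$ with $t(a_{k-1})=s(a_k)$. $D_3^*$ is the species of trivalent diagrams (not necessarily connected) and $D_3$ the species of connected trivalent diagrams, the structures on $E$ being those with arc set $E$. -}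

module Defs where

open import Data.Nat using (ℕ; zero; suc)
open import Data.Fin using (Fin)
open import Data.Integer using (ℤ; 0ℤ) renaming (_+_ to _+ℤ_)
open import Data.Product using (Σ; ∃; _×_; _,_; proj₁; proj₂)
open import Data.Sum using (_⊎_; inj₁; inj₂)
open import Function using (_∘_)
open import Function.Bundles using (_↔_; Inverse; mk↔ₛ′)
open import Function.Properties.Inverse using (↔-refl; ↔-trans)
open import Data.Product.Function.Dependent.Propositional using (Σ-↔)
open import Relation.Binary.PropositionalEquality
  using (_≡_; _≢_; refl; sym; trans; cong; subst)

open Inverse using (to; from; strictlyInverseˡ; strictlyInverseʳ)

-- Structures live in a type  Str E ; equality of structures (the
-- structures being, e.g., diagrams "up to isomorphism") is given by
-- an explicit relation  _≈_ ; transport along bijections is  transport .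

record Species : Set₁ where
  field
    Str       : Set → Set
    _≈_       : {E : Set} → Str E → Str E → Set
    transport : {E E′ : Set} → E ↔ E′ → Str E → Str E′

Finite : Set → Set
Finite E = Σ ℕ (λ n → Fin n ↔ E)

record NatIso (F G : Species) : Set₁ where
  module F = Species F
  module G = Species G
  field
    fwd      : {E : Set} → Finite E → F.Str E → G.Str E
    bwd      : {E : Set} → Finite E → G.Str E → F.Str E
    fwd-cong : {E : Set} (w : Finite E) {x y : F.Str E} →
               x F.≈ y → fwd w x G.≈ fwd w y
    bwd-cong : {E : Set} (w : Finite E) {x y : G.Str E} →
               x G.≈ y → bwd w x F.≈ bwd w y
    bwd-fwd  : {E : Set} (w : Finite E) (x : F.Str E) → bwd w (fwd w x) F.≈ x
    fwd-bwd  : {E : Set} (w : Finite E) (y : G.Str E) → fwd w (bwd w y) G.≈ y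
    natural  : {E E′ : Set} (w : Finite E) (w′ : Finite E′) (β : E ↔ E′)
               (x : F.Str E) →
               fwd w′ (F.transport β x) G.≈ G.transport β (fwd w x)

≡-subst-↔ : {m : ℕ} {u v x : Fin m} → u ≡ v → (u ≡ x) ↔ (v ≡ x)
≡-subst-↔ refl = ↔-refl

Fiber : {E : Set} {m : ℕ} → (E → Fin m) → Fin m → Set
Fiber {E} f x = Σ E (λ a → f a ≡ x)

Fiber-↔ : {E E′ : Set} {m : ℕ} (β : E ↔ E′) (f : E → Fin m) (x : Fin m) →
          Fiber f x ↔ Fiber (f ∘ from β) x
Fiber-↔ β f x = Σ-↔ β (λ {a} → ≡-subst-↔ (sym (cong f (strictlyInverseʳ β a))))

-- Diagrams with arc set E.  The vertex set Γ₀ is taken to be Fin m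
-- (it is finite: s is onto, E finite; diagrams are only considered up
-- to isomorphism).  The Z-action is written  a +ᵃ k .

record Diagram (E : Set) : Set where
  field
    m           : ℕ
    s t         : E → Fin m
    inv         : E → E
    inv-inv     : ∀ a → inv (inv a) ≡ a
    s-inv       : ∀ a → s (inv a) ≡ t a
    t-inv       : ∀ a → t (inv a) ≡ s a
    _+ᵃ_        : E → ℤ → E
    act-zero    : ∀ a → a +ᵃ 0ℤ ≡ a
    act-assoc   : ∀ a k l → (a +ᵃ k) +ᵃ l ≡ a +ᵃ (k +ℤ l)
    orbit⊆star  : ∀ a k → s (a +ᵃ k) ≡ s a
    star⊆orbit  : ∀ a b → s a ≡ s b → ∃ (λ k → a +ᵃ k ≡ b)
    no-isolated : ∀ x → ∃ (λ a → s a ≡ x)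

record DiagIso {E : Set} (D D′ : Diagram E) : Set where
  module D  = Diagram D
  module D′ = Diagram D′
  field
    φ      : Fin D.m ↔ Fin D′.m
    φ-s    : ∀ a → to φ (D.s a) ≡ D′.s a
    φ-t    : ∀ a → to φ (D.t a) ≡ D′.t a
    inv-eq : ∀ a → D.inv a ≡ D′.inv a
    act-eq : ∀ a k → D._+ᵃ_ a k ≡ D′._+ᵃ_ a k

Star : {E : Set} (D : Diagram E) → Fin (Diagram.m D) → Set
Star D x = Fiber (Diagram.s D) x

HasSize : ℕ → Set → Set
HasSize k A = Fin k ↔ A

Trivalent : {E : Set} → Diagram E → Set
Trivalent D = ∀ x → HasSize 1 (Star D x) ⊎ HasSize 3 (Star D x)

data Chain {E : Set} (D : Diagram E) : Fin (Diagram.m D) → Fin (Diagram.m D) → Set where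
  one  : ∀ {x y} a → Diagram.s D a ≡ x → Diagram.t D a ≡ y → Chain D x y
  cons : ∀ {x y} a → Diagram.s D a ≡ x → Chain D (Diagram.t D a) y → Chain D x y

Connected : {E : Set} → Diagram E → Set
Connected D = ∀ x y → x ≢ y → Chain D x y

transportD : {E E′ : Set} → E ↔ E′ → Diagram E → Diagram E′
transportD {E} {E′} β D = record
  { m = m
  ; s = s ∘ from β
  ; t = t ∘ from β
  ; inv = to β ∘ inv ∘ from β
  ; inv-inv = λ a → trans (cong (to β ∘ inv) (strictlyInverseʳ β (inv (from β a))))
                    (trans (cong (to β) (inv-inv (from β a))) (strictlyInverseˡ β a))
  ; s-inv = λ a → trans (cong s (strictlyInverseʳ β _)) (s-inv _)
  ; t-inv = λ a → trans (cong t (strictlyInverseʳ β _)) (t-inv _)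
  ; _+ᵃ_ = λ a k → to β (from β a +ᵃ k)
  ; act-zero = λ a → trans (cong (to β) (act-zero (from β a))) (strictlyInverseˡ β a)
  ; act-assoc = λ a k l → trans (cong (λ z → to β (z +ᵃ l)) (strictlyInverseʳ β _))
                           (cong (to β) (act-assoc (from β a) k l))
  ; orbit⊆star = λ a k → trans (cong s (strictlyInverseʳ β _)) (orbit⊆star _ _)
  ; star⊆orbit = λ a b e → let r = star⊆orbit (from β a) (from β b) e in
                   proj₁ r , trans (cong (to β) (proj₂ r)) (strictlyInverseˡ β b)
  ; no-isolated = λ x → let r = no-isolated x in
                   to β (proj₁ r) , trans (cong s (strictlyInverseʳ β _)) (proj₂ r)
  }
  where open Diagram D

transport-Trivalent : {E E′ : Set} (β : E ↔ E′) (D : Diagram E) →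
                      Trivalent D → Trivalent (transportD β D)
transport-Trivalent β D tri x with tri x
... | inj₁ h = inj₁ (↔-trans h (Fiber-↔ β (Diagram.s D) x))
... | inj₂ h = inj₂ (↔-trans h (Fiber-↔ β (Diagram.s D) x))

transport-Chain : {E E′ : Set} (β : E ↔ E′) (D : Diagram E) {x y : Fin (Diagram.m D)} →
                  Chain D x y → Chain (transportD β D) x y
transport-Chain β D (one a e₁ e₂) =
  one (to β a) (trans (cong (Diagram.s D) (strictlyInverseʳ β a)) e₁)
               (trans (cong (Diagram.t D) (strictlyInverseʳ β a)) e₂)
transport-Chain β D {y = y} (cons a e c) =
  cons (to β a) (trans (cong (Diagram.s D) (strictlyInverseʳ β a)) e)
       (subst (λ z → Chain (transportD β D) z y)
              (sym (cong (Diagram.t D) (strictlyInverseʳ β a)))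
              (transport-Chain β D c))

transport-Connected : {E E′ : Set} (β : E ↔ E′) (D : Diagram E) →
                      Connected D → Connected (transportD β D)
transport-Connected β D con x y x≢y = transport-Chain β D (con x y x≢y)

D₃* : Species
D₃* = record
  { Str = λ E → Σ (Diagram E) Trivalent
  ; _≈_ = λ x y → DiagIso (proj₁ x) (proj₁ y)
  ; transport = λ β x → transportD β (proj₁ x) , transport-Trivalent β (proj₁ x) (proj₂ x)
  }

D₃ : Species
D₃ = record
  { Str = λ E → Σ (Diagram E) (λ D → Trivalent D × Connected D)
  ; _≈_ = λ x y → DiagIso (proj₁ x) (proj₁ y)
  ; transport = λ β x → transportD β (proj₁ x)
                      , transport-Trivalent β (proj₁ x) (proj₁ (proj₂ x))
                      , transport-Connected β (proj₁ x) (proj₂ (proj₂ x))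
  }

pow : {A : Set} → ℕ → (A → A) → A → A
pow zero    f a = a
pow (suc k) f a = f (pow k f a)

conj : {E E′ : Set} → E ↔ E′ → E ↔ E → E′ ↔ E′
conj β σ = mk↔ₛ′ (to β ∘ to σ ∘ from β) (to β ∘ from σ ∘ from β)
  (λ y → trans (cong (to β ∘ to σ) (strictlyInverseʳ β _))
         (trans (cong (to β) (strictlyInverseˡ σ _)) (strictlyInverseˡ β y)))
  (λ y → trans (cong (to β ∘ from σ) (strictlyInverseʳ β _))
         (trans (cong (to β) (strictlyInverseʳ σ _)) (strictlyInverseˡ β y)))

pow-conj : {E E′ : Set} (β : E ↔ E′) (σ : E ↔ E) (k : ℕ) (a : E′) →
           pow k (to (conj β σ)) a ≡ to β (pow k (to σ) (from β a))
pow-conj β σ zero    a = sym (strictlyInverseˡ β a)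
pow-conj β σ (suc k) a =
  trans (cong (to β ∘ to σ ∘ from β) (pow-conj β σ k a))
        (cong (to β ∘ to σ) (strictlyInverseʳ β _))

S : ℕ → Species
S n = record
  { Str = λ E → Σ (E ↔ E) (λ σ → ∀ a → pow n (to σ) a ≡ a)
  ; _≈_ = λ x y → ∀ a → to (proj₁ x) a ≡ to (proj₁ y) a
  ; transport = λ β x → conj β (proj₁ x)
      , (λ a → trans (pow-conj β (proj₁ x) n a)
               (trans (cong (to β) (proj₂ x (from β a))) (strictlyInverseˡ β a)))
  }

_×ˢ_ : Species → Species → Species
F ×ˢ G = record
  { Str = λ E → F.Str E × G.Str E
  ; _≈_ = λ x y → (proj₁ x F.≈ proj₁ y) × (proj₂ x G.≈ proj₂ y)
  ; transport = λ β x → F.transport β (proj₁ x) , G.transport β (proj₂ x)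
  }
  where module F = Species F
        module G = Species G

-- A partition is presented by a surjective
-- block-labelling  block : E → Fin k ; labellings differing by a
-- relabelling of the blocks are identified by  EnsEq .

record Partitioned (F : Species) (E : Set) : Set where
  field
    k        : ℕ
    block    : E → Fin k
    nonempty : ∀ i → ∃ (λ e → block e ≡ i)
    struct   : (i : Fin k) → Species.Str F (Fiber block i)

record EnsEq (F : Species) {E : Set} (x y : Partitioned F E) : Set where
  module x = Partitioned x
  module y = Partitioned y
  field
    π        : Fin x.k ↔ Fin y.k
    π-block  : ∀ e → to π (x.block e) ≡ y.block e
    π-struct : ∀ i → Σ (Fiber x.block i ↔ Fiber y.block (to π i)) (λ γ →
                 (∀ u → proj₁ (to γ u) ≡ proj₁ u) ×
                 Species._≈_ F (Species.transport F γ (x.struct i)) (y.struct (to π i)))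

transportEns : (F : Species) {E E′ : Set} → E ↔ E′ → Partitioned F E → Partitioned F E′
transportEns F β x = record
  { k = k
  ; block = block ∘ from β
  ; nonempty = λ i → let r = nonempty i in
      to β (proj₁ r) , trans (cong block (strictlyInverseʳ β _)) (proj₂ r)
  ; struct = λ i → Species.transport F (Fiber-↔ β block i) (struct i)
  }
  where open Partitioned x

Ens : Species → Species
Ens F = record
  { Str = Partitioned F
  ; _≈_ = EnsEq F
  ; transport = transportEns F
  }

{-# OPTIONS --safe #-}

-- A trivalent diagram with arc set E amounts to two permutations of E: the involution
-- τ : a ↦ a⁻¹ and the rotation σ : a ↦ a + 1.  The stars are the σ-orbits and have one or three
-- elements, so σ³ = id; conversely the vertices are recovered as the σ-orbits.  This gives
-- D₃* ≃ S₂ × S₃, and since a diagram is determined up to isomorphism by τ and σ, every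
-- coherence condition reduces to pointwise equalities of these two permutations.
--
-- For Ens(D₃) ≃ D₃*, the permutations of the blocks of a partition glue to permutations of E;
-- conversely a diagram splits into its connected components, the orbits of the group generated
-- by τ and σ.  They are the classes of "reachable by a word of length at most |E|", a decidable
-- relation, because by the pigeonhole principle every word can be shortened to that length.

module Submission where

open import Defs
open import Data.Empty using (⊥-elim)
open import Data.Fin as Fin using (Fin; zero; suc; toℕ; _≟_)
open import Data.Fin.Properties using (pigeonhole; any?; inj⇒≟; +↔⊎; toℕ<n; toℕ≤pred[n]; ≤-antisym; <-cmp)
open import Data.List using (List; []; _∷_; _++_; length; take; drop)
open import Data.List.Properties using (length-++; length-take; length-drop; take++drop≡id)
open import Data.Integer as ℤ using (ℤ; +_; -[1+_]; 1ℤ; -1ℤ)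
import Data.Integer.Properties as ℤ
open import Data.Nat as ℕ using (ℕ; zero; suc; _+_; _∸_; _≤_; _<_; z≤n; s≤s)
import Data.Nat.Properties as ℕ
open import Data.Product using (Σ; ∃; _×_; _,_; proj₁; proj₂)
open import Data.Sum using (_⊎_; inj₁; inj₂)
open import Data.Sum.Function.Propositional using (_⊎-cong_)
open import Function using (_∘_; id)
open import Function.Bundles using (_↔_; Inverse; Injection; mk↔ₛ′)
open import Function.Properties.Inverse using (↔-refl; ↔-sym; ↔-trans; ↔⇒↣)
open import Data.Product.Function.Dependent.Propositional using (Σ-↔)
open import Relation.Binary.Definitions using (Decidable; DecidableEquality; tri<; tri≈; tri>)
open import Relation.Binary.Structures using (IsEquivalence)
open import Relation.Nullary using (Dec; yes; no; Irrelevant; _⊎-dec_)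
open import Relation.Binary.PropositionalEquality
open import Relation.Binary.PropositionalEquality.WithK using (≡-irrelevant)

open Inverse using (to; from; strictlyInverseˡ; strictlyInverseʳ)

private
  variable
    A B E : Set

to-injective : (h : A ↔ B) {x y : A} → to h x ≡ to h y → x ≡ y
to-injective h = Injection.injective (↔⇒↣ h)

from-injective : (h : A ↔ B) {x y : B} → from h x ≡ from h y → x ≡ y
from-injective h = to-injective (↔-sym h)

subtype-≡ : {P : A → Set} → (∀ a → Irrelevant (P a)) → {u v : Σ A P} → proj₁ u ≡ proj₁ v → u ≡ v
subtype-≡ irr {a , p} {.a , q} refl = cong (a ,_) (irr a p q)

Fiber-≡ : {m : ℕ} {f : E → Fin m} {i : Fin m} {u v : Fiber f i} → proj₁ u ≡ proj₁ v → u ≡ v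
Fiber-≡ = subtype-≡ (λ _ → ≡-irrelevant)

-- Iteration

pow-comm : (f : A → A) (n : ℕ) (a : A) → pow n f (f a) ≡ f (pow n f a)
pow-comm f zero    a = refl
pow-comm f (suc n) a = cong f (pow-comm f n a)

pow-+ : (f : A → A) (m n : ℕ) (a : A) → pow m f (pow n f a) ≡ pow (m + n) f a
pow-+ f zero    n a = refl
pow-+ f (suc m) n a = cong f (pow-+ f m n a)

pow-natural : {f : A → A} {g : B → B} (h : A → B) → (∀ a → h (f a) ≡ g (h a)) →
              ∀ n a → h (pow n f a) ≡ pow n g (h a)
pow-natural         h comm zero    a = refl
pow-natural {g = g} h comm (suc n) a = trans (comm _) (cong g (pow-natural h comm n a))

pow-fixed : (f : A → A) {a : A} → f a ≡ a → ∀ n → pow n f a ≡ a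
pow-fixed f fa≡a zero    = refl
pow-fixed f fa≡a (suc n) = trans (cong f (pow-fixed f fa≡a n)) fa≡a

module _ {f : A → A} (f-injective : ∀ {a b} → f a ≡ f b → a ≡ b) where

  pow-injective : ∀ n {a b} → pow n f a ≡ pow n f b → a ≡ b
  pow-injective zero    e = e
  pow-injective (suc n) e = pow-injective n (f-injective e)

  pow-cancel : ∀ {i j} a → i ≤ j → pow i f a ≡ pow j f a → pow (j ∸ i) f a ≡ a
  pow-cancel {i} {j} a i≤j e = pow-injective i (begin
    pow i f (pow (j ∸ i) f a) ≡⟨ pow-+ f i (j ∸ i) a ⟩
    pow (i + (j ∸ i)) f a     ≡⟨ cong (λ n → pow n f a) (ℕ.m+[n∸m]≡n i≤j) ⟩
    pow j f a                 ≡⟨ sym e ⟩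
    pow i f a                 ∎)
    where open ≡-Reasoning

iterateℤ : (f f⁻¹ : A → A) → ℤ → A → A
iterateℤ f f⁻¹ (+ n)    = pow n f
iterateℤ f f⁻¹ -[1+ n ] = pow (suc n) f⁻¹

iterateℤ-natural : {f f⁻¹ : A → A} {g g⁻¹ : B → B} (h : A → B) →
                   (∀ a → h (f a) ≡ g (h a)) → (∀ a → h (f⁻¹ a) ≡ g⁻¹ (h a)) →
                   ∀ k a → h (iterateℤ f f⁻¹ k a) ≡ iterateℤ g g⁻¹ k (h a)
iterateℤ-natural {g = g}     h comm comm⁻¹ (+ n)    = pow-natural {g = g} h comm n
iterateℤ-natural {g⁻¹ = g⁻¹} h comm comm⁻¹ -[1+ n ] = pow-natural {g = g⁻¹} h comm⁻¹ (suc n)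

module _ {f f⁻¹ : A → A} (f⁻¹∘f : ∀ a → f⁻¹ (f a) ≡ a) (f∘f⁻¹ : ∀ a → f (f⁻¹ a) ≡ a) where

  private
    iter = iterateℤ f f⁻¹

  iterateℤ-+1 : ∀ k a → iter (k ℤ.+ 1ℤ) a ≡ f (iter k a)
  iterateℤ-+1 (+ m)        a = cong (λ n → pow n f a) (ℕ.+-comm m 1)
  iterateℤ-+1 -[1+ zero ]  a = sym (f∘f⁻¹ a)
  iterateℤ-+1 -[1+ suc m ] a = sym (f∘f⁻¹ _)

  iterateℤ-−1 : ∀ k a → iter (k ℤ.+ -1ℤ) a ≡ f⁻¹ (iter k a)
  iterateℤ-−1 (+ zero)  a = refl
  iterateℤ-−1 (+ suc m) a = sym (f⁻¹∘f _)
  iterateℤ-−1 -[1+ m ]  a = cong (λ n → pow (suc (suc n)) f⁻¹ a) (ℕ.+-identityʳ m)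

  iterateℤ-+ : ∀ k l a → iter l (iter k a) ≡ iter (k ℤ.+ l) a
  iterateℤ-+ k (+ zero)     a = cong (λ l → iter l a) (sym (ℤ.+-identityʳ k))
  iterateℤ-+ k (+ suc n)    a = begin
    f (pow n f (iter k a))          ≡⟨ sym (pow-comm f n _) ⟩
    pow n f (f (iter k a))          ≡⟨ cong (pow n f) (sym (iterateℤ-+1 k a)) ⟩
    iter (+ n) (iter (k ℤ.+ 1ℤ) a)  ≡⟨ iterateℤ-+ (k ℤ.+ 1ℤ) (+ n) a ⟩
    iter (k ℤ.+ 1ℤ ℤ.+ + n) a       ≡⟨ cong (λ l → iter l a) (ℤ.+-assoc k 1ℤ (+ n)) ⟩
    iter (k ℤ.+ + suc n) a          ∎
    where open ≡-Reasoning
  iterateℤ-+ k -[1+ zero ]  a = sym (iterateℤ-−1 k a)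
  iterateℤ-+ k -[1+ suc n ] a = begin
    f⁻¹ (pow (suc n) f⁻¹ (iter k a))     ≡⟨ sym (pow-comm f⁻¹ (suc n) _) ⟩
    pow (suc n) f⁻¹ (f⁻¹ (iter k a))     ≡⟨ cong (pow (suc n) f⁻¹) (sym (iterateℤ-−1 k a)) ⟩
    iter -[1+ n ] (iter (k ℤ.+ -1ℤ) a)   ≡⟨ iterateℤ-+ (k ℤ.+ -1ℤ) -[1+ n ] a ⟩
    iter (k ℤ.+ -1ℤ ℤ.+ -[1+ n ]) a      ≡⟨ cong (λ l → iter l a) (ℤ.+-assoc k -1ℤ -[1+ n ]) ⟩
    iter (k ℤ.+ -[1+ suc n ]) a          ∎
    where open ≡-Reasoning

-- Finite sets and quotients

≟-finite : Finite E → DecidableEquality E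
≟-finite (n , w) = inj⇒≟ (↔⇒↣ (↔-sym w))

Σ-Fin-suc-↔ : {n : ℕ} {P : Fin (suc n) → Set} → Σ (Fin (suc n)) P ↔ (P zero ⊎ Σ (Fin n) (P ∘ suc))
Σ-Fin-suc-↔ = mk↔ₛ′
  (λ { (zero , p) → inj₁ p ; (suc i , p) → inj₂ (i , p) })
  (λ { (inj₁ p) → zero , p ; (inj₂ (i , p)) → suc i , p })
  (λ { (inj₁ _) → refl ; (inj₂ _) → refl })
  (λ { (zero , _) → refl ; (suc _ , _) → refl })

Dec-Irrelevant⇒Finite : {P : Set} → Dec P → Irrelevant P → Finite P
Dec-Irrelevant⇒Finite (yes p) irr = 1 , mk↔ₛ′ (λ _ → p) (λ _ → zero) (irr p) (λ { zero → refl })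
Dec-Irrelevant⇒Finite (no ¬p) irr = 0 , mk↔ₛ′ (λ ()) (⊥-elim ∘ ¬p) (⊥-elim ∘ ¬p) (λ ())

finite-Σ-Fin : (n : ℕ) {P : Fin n → Set} → (∀ i → Dec (P i)) → (∀ i → Irrelevant (P i)) → Finite (Σ (Fin n) P)
finite-Σ-Fin zero    P? irr = 0 , mk↔ₛ′ (λ ()) (λ { (() , _) }) (λ { (() , _) }) (λ ())
finite-Σ-Fin (suc n) P? irr with Dec-Irrelevant⇒Finite (P? zero) (irr zero)
                                 | finite-Σ-Fin n (P? ∘ suc) (irr ∘ suc)
... | b , Fin-b↔P₀ | m , Fin-m↔Σ = b + m , ↔-trans +↔⊎ (↔-trans (Fin-b↔P₀ ⊎-cong Fin-m↔Σ) (↔-sym Σ-Fin-suc-↔))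

finite-Σ : {P : E → Set} → Finite E → (∀ a → Dec (P a)) → (∀ a → Irrelevant (P a)) → Finite (Σ E P)
finite-Σ (n , w) P? irr with finite-Σ-Fin n (P? ∘ to w) (irr ∘ to w)
... | m , Fin-m↔Σ = m , ↔-trans Fin-m↔Σ (Σ-↔ w ↔-refl)

finite-Fiber : {m : ℕ} → Finite E → (f : E → Fin m) (i : Fin m) → Finite (Fiber f i)
finite-Fiber w f i = finite-Σ w (λ a → f a ≟ i) (λ _ → ≡-irrelevant)

Minimal : {n : ℕ} → (Fin n → Set) → Fin n → Set
Minimal Q i = Q i × (∀ j → Q j → i Fin.≤ j)

least : {n : ℕ} {Q : Fin n → Set} → (∀ i → Dec (Q i)) → Σ (Fin n) Q → Σ (Fin n) (Minimal Q)
least Q? (zero  , q₀) = zero , q₀ , λ _ _ → z≤n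
least Q? (suc i , qᵢ) with Q? zero
... | yes q₀ = zero , q₀ , λ _ _ → z≤n
... | no ¬q₀ with least (Q? ∘ suc) (i , qᵢ)
...   | j , qⱼ , j-minimal = suc j , qⱼ , λ { zero q₀ → ⊥-elim (¬q₀ q₀) ; (suc k) qₖ → s≤s (j-minimal k qₖ) }

Minimal-unique : {n : ℕ} {Q Q′ : Fin n → Set} {i i′ : Fin n} →
                 (∀ j → Q j → Q′ j) → (∀ j → Q′ j → Q j) → Minimal Q i → Minimal Q′ i′ → i ≡ i′
Minimal-unique Q⇒Q′ Q′⇒Q (qᵢ , i-minimal) (qᵢ′ , i′-minimal) =
  ≤-antisym (i-minimal _ (Q′⇒Q _ qᵢ′)) (i′-minimal _ (Q⇒Q′ _ qᵢ))

record Quotient (E : Set) (_~_ : E → E → Set) : Set where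
  field
    size             : ℕ
    class            : E → Fin size
    class-surjective : ∀ i → ∃ λ a → class a ≡ i
    ~⇒class≡         : ∀ {a b} → a ~ b → class a ≡ class b
    class≡⇒~         : ∀ {a b} → class a ≡ class b → a ~ b

quotient : {_~_ : E → E → Set} → Finite E → Decidable _~_ → IsEquivalence _~_ → Quotient E _~_
quotient {E = E} {_~_} (n , w) _~?_ ~-equivalence = record
  { size             = proj₁ Canonicals
  ; class            = class
  ; class-surjective = class-surjective
  ; ~⇒class≡         = λ a~b → cong (from c) (subtype-≡ (λ _ → ≡-irrelevant) (canonical-cong a~b))
  ; class≡⇒~         = class≡⇒~
  }
  where
  module ~ = IsEquivalence ~-equivalence

  canonical-minimal : ∀ a → Σ (Fin n) (Minimal (λ j → to w j ~ a))
  canonical-minimal a =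
    least (λ j → to w j ~? a) (from w a , subst (_~ a) (sym (strictlyInverseˡ w a)) ~.refl)

  canonical : E → Fin n
  canonical a = proj₁ (canonical-minimal a)

  canonical~ : ∀ a → to w (canonical a) ~ a
  canonical~ a = proj₁ (proj₂ (canonical-minimal a))

  canonical-cong : ∀ {a b} → a ~ b → canonical a ≡ canonical b
  canonical-cong a~b = Minimal-unique (λ _ j~a → ~.trans j~a a~b) (λ _ j~b → ~.trans j~b (~.sym a~b))
                                      (proj₂ (canonical-minimal _)) (proj₂ (canonical-minimal _))

  Canonicals : Finite (Σ (Fin n) λ j → canonical (to w j) ≡ j)
  Canonicals = finite-Σ-Fin n (λ j → canonical (to w j) ≟ j) (λ _ → ≡-irrelevant)

  c : Fin (proj₁ Canonicals) ↔ Σ (Fin n) λ j → canonical (to w j) ≡ j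
  c = proj₂ Canonicals

  class : E → Fin (proj₁ Canonicals)
  class a = from c (canonical a , canonical-cong (canonical~ a))

  class-surjective : ∀ i → ∃ λ a → class a ≡ i
  class-surjective i = to w (proj₁ (to c i)) , (begin
    from c (canonical (to w j) , _) ≡⟨ cong (from c) (subtype-≡ (λ _ → ≡-irrelevant) (proj₂ (to c i))) ⟩
    from c (to c i)                 ≡⟨ strictlyInverseʳ c i ⟩
    i                               ∎)
    where open ≡-Reasoning
          j = proj₁ (to c i)

  class≡⇒~ : ∀ {a b} → class a ≡ class b → a ~ b
  class≡⇒~ {a} {b} e = ~.trans (~.sym (canonical~ a))
    (subst (_~ b) (cong (to w ∘ proj₁) (sym (from-injective c e))) (canonical~ b))

module SameKernel {k k′ : ℕ} {f : E → Fin k} {g : E → Fin k′}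
                  (f-surjective : ∀ i → ∃ λ a → f a ≡ i) (g-surjective : ∀ j → ∃ λ a → g a ≡ j)
                  (f⇒g : ∀ {a b} → f a ≡ f b → g a ≡ g b) (g⇒f : ∀ {a b} → g a ≡ g b → f a ≡ f b)
                  where

  labels-↔ : Fin k ↔ Fin k′
  labels-↔ = mk↔ₛ′ (g ∘ proj₁ ∘ f-surjective) (f ∘ proj₁ ∘ g-surjective)
    (λ j → trans (f⇒g (proj₂ (f-surjective _))) (proj₂ (g-surjective j)))
    (λ i → trans (g⇒f (proj₂ (g-surjective _))) (proj₂ (f-surjective i)))

  labels-↔-commutes : ∀ a → to labels-↔ (f a) ≡ g a
  labels-↔-commutes a = f⇒g (proj₂ (f-surjective (f a)))

  fibers-↔ : ∀ i → Fiber f i ↔ Fiber g (to labels-↔ i)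
  fibers-↔ i = mk↔ₛ′
    (λ (a , fa≡i) → a , f⇒g (trans fa≡i (sym (proj₂ (f-surjective i)))))
    (λ (a , ga≡j) → a , trans (g⇒f ga≡j) (proj₂ (f-surjective i)))
    (λ _ → Fiber-≡ refl) (λ _ → Fiber-≡ refl)

-- Diagrams and their permutations of arcs

module _ (D : Diagram E) where
  open Diagram D

  next prev : E → E
  next a = a +ᵃ 1ℤ
  prev a = a +ᵃ -1ℤ

  prev-next : ∀ a → prev (next a) ≡ a
  prev-next a = trans (act-assoc a 1ℤ -1ℤ) (act-zero a)

  next-prev : ∀ a → next (prev a) ≡ a
  next-prev a = trans (act-assoc a -1ℤ 1ℤ) (act-zero a)

  next-injective : ∀ {a b} → next a ≡ next b → a ≡ b
  next-injective {a} {b} e = trans (sym (prev-next a)) (trans (cong prev e) (prev-next b))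

  s-next : ∀ a → s (next a) ≡ s a
  s-next a = orbit⊆star a 1ℤ

  s-pow-next : ∀ n a → s (pow n next a) ≡ s a
  s-pow-next zero    a = refl
  s-pow-next (suc n) a = trans (s-next _) (s-pow-next n a)

  act-+ : ∀ n a → a +ᵃ (+ n) ≡ pow n next a
  act-+ zero    a = act-zero a
  act-+ (suc n) a = begin
    a +ᵃ (+ suc n)        ≡⟨ sym (act-assoc a 1ℤ (+ n)) ⟩
    next a +ᵃ (+ n)       ≡⟨ act-+ n (next a) ⟩
    pow n next (next a)   ≡⟨ pow-comm next n a ⟩
    next (pow n next a)   ∎
    where open ≡-Reasoning

  module _ {ρ : E → E} (ρ∘next : ∀ a → ρ (next a) ≡ a) where

    prev≗ρ : ∀ a → prev a ≡ ρ a
    prev≗ρ a = trans (sym (ρ∘next (prev a))) (cong ρ (next-prev a))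

    act-− : ∀ n a → a +ᵃ -[1+ n ] ≡ pow (suc n) ρ a
    act-− zero    a = prev≗ρ a
    act-− (suc n) a = begin
      a +ᵃ -[1+ suc n ]              ≡⟨ sym (act-assoc a -1ℤ -[1+ n ]) ⟩
      prev a +ᵃ -[1+ n ]             ≡⟨ act-− n (prev a) ⟩
      pow (suc n) ρ (prev a)         ≡⟨ cong (pow (suc n) ρ) (prev≗ρ a) ⟩
      pow (suc n) ρ (ρ a)            ≡⟨ pow-comm ρ (suc n) a ⟩
      ρ (pow (suc n) ρ a)            ∎
      where open ≡-Reasoning

    act≡iterateℤ : ∀ k a → a +ᵃ k ≡ iterateℤ next ρ k a
    act≡iterateℤ (+ n)    = act-+ n
    act≡iterateℤ -[1+ n ] = act-− n

same-act⇒same-star : (D D′ : Diagram E) → (∀ a k → Diagram._+ᵃ_ D a k ≡ Diagram._+ᵃ_ D′ a k) →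
            ∀ {a b} → Diagram.s D a ≡ Diagram.s D b → Diagram.s D′ a ≡ Diagram.s D′ b
same-act⇒same-star D D′ act≡ {a} sa≡sb with Diagram.star⊆orbit D a _ sa≡sb
... | k , a+k≡b = trans (sym (Diagram.orbit⊆star D′ a k)) (cong (Diagram.s D′) (trans (sym (act≡ a k)) a+k≡b))

module _ {D D′ : Diagram E} where
  private
    module D  = Diagram D
    module D′ = Diagram D′

  next-determines-act : next D ≗ next D′ → ∀ a k → D._+ᵃ_ a k ≡ D′._+ᵃ_ a k
  next-determines-act next≗ a k = begin
    D._+ᵃ_ a k                       ≡⟨ act≡iterateℤ D (prev-next D) k a ⟩
    iterateℤ (next D) (prev D) k a   ≡⟨ iterateℤ-natural id next≗ (λ _ → refl) k a ⟩
    iterateℤ (next D′) (prev D) k a  ≡⟨ sym (act≡iterateℤ D′ prev∘next′ k a) ⟩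
    D′._+ᵃ_ a k                      ∎
    where
    open ≡-Reasoning
    prev∘next′ : ∀ a → prev D (next D′ a) ≡ a
    prev∘next′ a = trans (cong (prev D) (sym (next≗ a))) (prev-next D a)

  inv-next⇒DiagIso : Diagram.inv D ≗ Diagram.inv D′ → next D ≗ next D′ → DiagIso D D′
  inv-next⇒DiagIso inv≗ next≗ = record
    { φ      = labels-↔
    ; φ-s    = labels-↔-commutes
    ; φ-t    = λ a → begin
        to labels-↔ (D.t a)          ≡⟨ cong (to labels-↔) (sym (D.s-inv a)) ⟩
        to labels-↔ (D.s (D.inv a))  ≡⟨ labels-↔-commutes (D.inv a) ⟩
        D′.s (D.inv a)               ≡⟨ cong D′.s (inv≗ a) ⟩
        D′.s (D′.inv a)              ≡⟨ D′.s-inv a ⟩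
        D′.t a                       ∎
    ; inv-eq = inv≗
    ; act-eq = next-determines-act next≗
    }
    where
    open ≡-Reasoning
    open SameKernel D.no-isolated D′.no-isolated
           (same-act⇒same-star D D′ (next-determines-act next≗)) (same-act⇒same-star D′ D (λ a k → sym (next-determines-act next≗ a k)))

module _ (D : Diagram E) where
  open Diagram D

  private
    OneOf : E → E → Set
    OneOf a b = b ≡ a ⊎ b ≡ next D a

    index : ∀ {a b} → OneOf a b → Fin 2
    index (inj₁ _) = zero
    index (inj₂ _) = suc zero

    index-injective : ∀ {a b c} (u : OneOf a b) (v : OneOf a c) → index u ≡ index v → b ≡ c
    index-injective (inj₁ b≡a)  (inj₁ c≡a)  _ = trans b≡a (sym c≡a)
    index-injective (inj₂ b≡a′) (inj₂ c≡a′) _ = trans b≡a′ (sym c≡a′)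

    OneOf-pow : ∀ {a} (f : E → E) → OneOf a (f a) → OneOf a (f (next D a)) → ∀ n → OneOf a (pow n f a)
    OneOf-pow f fa fa′ zero = inj₁ refl
    OneOf-pow f fa fa′ (suc n) with OneOf-pow f fa fa′ n
    ... | inj₁ fⁿa≡a  = subst (OneOf _ ∘ f) (sym fⁿa≡a) fa
    ... | inj₂ fⁿa≡a′ = subst (OneOf _ ∘ f) (sym fⁿa≡a′) fa′

  star-of-period-two : ∀ {a} → pow 2 (next D) a ≡ a → ∀ b → s b ≡ s a → b ≡ a ⊎ b ≡ next D a
  star-of-period-two {a} period b sb≡sa with star⊆orbit a b (sym sb≡sa)
  ... | k , a+k≡b = subst (OneOf a) (trans (sym (act≡iterateℤ D (prev-next D) k a)) a+k≡b) (orbit k)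
    where
    prev-a : OneOf a (prev D a)
    prev-a = inj₂ (trans (cong (prev D) (sym period)) (prev-next D _))
    orbit : ∀ k → OneOf a (iterateℤ (next D) (prev D) k a)
    orbit (+ n)    = OneOf-pow (next D) (inj₂ refl) (inj₁ period) n
    orbit -[1+ n ] = OneOf-pow (prev D) prev-a (inj₁ (prev-next D a)) (suc n)

  no-period-two : ∀ {a} → HasSize 3 (Star D (s a)) → pow 2 (next D) a ≢ a
  no-period-two {a} Fin3↔star period with pigeonhole (ℕ.n<1+n 2) (index ∘ one-of)
    where
    one-of : (i : Fin 3) → OneOf a (proj₁ (to Fin3↔star i))
    one-of i = star-of-period-two period _ (proj₂ (to Fin3↔star i))
  ... | i , j , i<j , same-index =
    ℕ.<-irrefl (cong toℕ (to-injective Fin3↔star (Fiber-≡ (index-injective _ _ same-index)))) i<j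

  period-three : Trivalent D → ∀ a → pow 3 (next D) a ≡ a
  period-three trivalent a with trivalent (s a)
  ... | inj₁ Fin1↔star = pow-fixed (next D) (cong proj₁ next-a≡a) 3
    where
    Fin1-≡ : (i j : Fin 1) → i ≡ j
    Fin1-≡ zero zero = refl
    next-a≡a : _≡_ {A = Star D (s a)} (next D a , s-next D a) (a , refl)
    next-a≡a = from-injective Fin1↔star (Fin1-≡ _ _)
  ... | inj₂ Fin3↔star with pigeonhole (ℕ.n<1+n 3) (from Fin3↔star ∘ orbit-point)
    where
    orbit-point : Fin 4 → Star D (s a)
    orbit-point i = pow (toℕ i) (next D) a , s-pow-next D (toℕ i) a
  ... | i , j , i<j , same-point =
    period-divides-three (toℕ j ∸ toℕ i) (ℕ.m<n⇒0<n∸m i<j) (ℕ.≤-trans (ℕ.m∸n≤m (toℕ j) (toℕ i)) (toℕ≤pred[n] j))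
      (pow-cancel (next-injective D) a (ℕ.<⇒≤ i<j) (cong proj₁ (from-injective Fin3↔star same-point)))
    where
    period-divides-three : ∀ d → 0 < d → d ≤ 3 → pow d (next D) a ≡ a → pow 3 (next D) a ≡ a
    period-divides-three 1 _ _ period = pow-fixed (next D) period 3
    period-divides-three 2 _ _ period = ⊥-elim (no-period-two Fin3↔star period)
    period-divides-three 3 _ _ period = period
    period-divides-three (suc (suc (suc (suc _)))) _ (s≤s (s≤s (s≤s ())))

-- Trivalent diagrams as pairs of permutations

record C₂*C₃-Action (E : Set) : Set where
  field
    τ σ          : E → E
    τ-involutive : ∀ a → τ (τ a) ≡ a
    σ³≡id        : ∀ a → pow 3 σ a ≡ a

  σ-injective : ∀ {a b} → σ a ≡ σ b → a ≡ b
  σ-injective {a} {b} e = trans (sym (σ³≡id a)) (trans (cong (σ ∘ σ) e) (σ³≡id b))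

actionOf : (D : Diagram E) → Trivalent D → C₂*C₃-Action E
actionOf D trivalent = record
  { τ            = Diagram.inv D
  ; σ            = next D
  ; τ-involutive = Diagram.inv-inv D
  ; σ³≡id        = period-three D trivalent
  }

module σ-Orbits (w : Finite E) (A : C₂*C₃-Action E) where
  open C₂*C₃-Action A

  _~_ : E → E → Set
  a ~ b = Σ (Fin 3) λ i → pow (toℕ i) σ a ≡ b

  ~-pow : ∀ n a → a ~ pow n σ a
  ~-pow zero    a = zero , refl
  ~-pow (suc n) a with ~-pow n a
  ... | zero           , σⁱa≡σⁿa = suc zero , cong σ σⁱa≡σⁿa
  ... | suc zero       , σⁱa≡σⁿa = suc (suc zero) , cong σ σⁱa≡σⁿa
  ... | suc (suc zero) , σⁱa≡σⁿa = zero , trans (sym (σ³≡id a)) (cong σ σⁱa≡σⁿa)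

  ~-sym : ∀ {a b} → a ~ b → b ~ a
  ~-sym     (zero           , refl) = zero , refl
  ~-sym {a} (suc zero       , refl) = suc (suc zero) , σ³≡id a
  ~-sym {a} (suc (suc zero) , refl) = suc zero , σ³≡id a

  ~-trans : ∀ {a b c} → a ~ b → b ~ c → a ~ c
  ~-trans {a} (i , refl) (j , refl) = subst (a ~_) (sym (pow-+ σ (toℕ j) (toℕ i) a)) (~-pow (toℕ j + toℕ i) a)

  ~-isEquivalence : IsEquivalence _~_
  ~-isEquivalence = record { refl = zero , refl ; sym = ~-sym ; trans = ~-trans }

  _~?_ : Decidable _~_
  a ~? b = any? (λ i → ≟-finite w (pow (toℕ i) σ a) b)

  -- Abstract: only the Quotient interface is used, and unfolding the construction is very expensive.
  abstract
    orbits : Quotient E _~_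
    orbits = quotient w _~?_ ~-isEquivalence

  open Quotient orbits public

  act : E → ℤ → E
  act a k = iterateℤ σ (σ ∘ σ) k a

  ~-act : ∀ a k → a ~ act a k
  ~-act a (+ n)    = ~-pow n a
  ~-act a -[1+ n ] = ~-pow-σ² (suc n)
    where
    ~-pow-σ² : ∀ n → a ~ pow n (σ ∘ σ) a
    ~-pow-σ² zero    = zero , refl
    ~-pow-σ² (suc n) = ~-trans (~-pow-σ² n) (suc (suc zero) , refl)

  module _ {r : E} (σr≢r : σ r ≢ r) where
    private
      short-period : ∀ d → 0 < d → d < 3 → pow d σ r ≡ r → σ r ≡ r
      short-period 1 _ _ period = period
      short-period 2 _ _ period = trans (cong σ (sym period)) (σ³≡id r)
      short-period (suc (suc (suc _))) _ (s≤s (s≤s (s≤s ())))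

      distinct : {i j : Fin 3} → i Fin.< j → pow (toℕ i) σ r ≢ pow (toℕ j) σ r
      distinct {i} {j} i<j σⁱr≡σʲr = σr≢r (short-period (toℕ j ∸ toℕ i) (ℕ.m<n⇒0<n∸m i<j)
        (ℕ.≤-<-trans (ℕ.m∸n≤m (toℕ j) (toℕ i)) (toℕ<n j)) (pow-cancel σ-injective r (ℕ.<⇒≤ i<j) σⁱr≡σʲr))

    orbit-injective : ∀ i j → pow (toℕ i) σ r ≡ pow (toℕ j) σ r → i ≡ j
    orbit-injective i j σⁱr≡σʲr with <-cmp i j
    ... | tri< i<j _ _ = ⊥-elim (distinct i<j σⁱr≡σʲr)
    ... | tri≈ _ i≡j _ = i≡j
    ... | tri> _ _ j<i = ⊥-elim (distinct j<i (sym σⁱr≡σʲr))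

module _ (w : Finite E) (A : C₂*C₃-Action E) where
  open C₂*C₃-Action A
  open σ-Orbits w A

  diagramOf : Diagram E
  diagramOf = record
    { m           = size
    ; s           = class
    ; t           = class ∘ τ
    ; inv         = τ
    ; inv-inv     = τ-involutive
    ; s-inv       = λ _ → refl
    ; t-inv       = λ a → cong class (τ-involutive a)
    ; _+ᵃ_        = act
    ; act-zero    = λ _ → refl
    ; act-assoc   = λ a k l → iterateℤ-+ {f = σ} {f⁻¹ = σ ∘ σ} σ³≡id σ³≡id k l a
    ; orbit⊆star  = λ a k → sym (~⇒class≡ (~-act a k))
    ; star⊆orbit  = λ a b sa≡sb → let i , σⁱa≡b = class≡⇒~ sa≡sb in + toℕ i , σⁱa≡b
    ; no-isolated = class-surjective
    }

  diagramOf-trivalent : Trivalent diagramOf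
  diagramOf-trivalent x with class-surjective x
  ... | r , r∈x with ≟-finite w (σ r) r
  ...   | yes σr≡r = inj₁ (mk↔ₛ′ (λ _ → r , r∈x) (λ _ → zero) (λ (b , b∈x) → Fiber-≡ (r≡ b∈x)) (λ { zero → refl }))
    where
    r≡ : ∀ {b} → class b ≡ x → r ≡ b
    r≡ b∈x = let i , σⁱr≡b = class≡⇒~ (trans r∈x (sym b∈x)) in trans (sym (pow-fixed σ σr≡r (toℕ i))) σⁱr≡b
  ...   | no σr≢r = inj₂ (mk↔ₛ′ point position point-position position-point)
    where
    point : Fin 3 → Fiber class x
    point i = pow (toℕ i) σ r , trans (sym (~⇒class≡ (i , refl))) r∈x
    position : Fiber class x → Fin 3
    position (b , b∈x) = proj₁ (class≡⇒~ (trans r∈x (sym b∈x)))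
    point-position : ∀ u → point (position u) ≡ u
    point-position (b , b∈x) = Fiber-≡ (proj₂ (class≡⇒~ (trans r∈x (sym b∈x))))
    position-point : ∀ i → position (point i) ≡ i
    position-point i = orbit-injective σr≢r (position (point i)) i (proj₂ (class≡⇒~ (trans r∈x (sym (proj₂ (point i))))))

permutationsOf : Finite E → Species.Str D₃* E → Species.Str (S 2 ×ˢ S 3) E
permutationsOf _ (D , trivalent) =
  (mk↔ₛ′ inv inv inv-inv inv-inv , inv-inv) ,
  (mk↔ₛ′ (next D) (prev D) (next-prev D) (prev-next D) , period-three D trivalent)
  where open Diagram D

diagramOfPermutations : Finite E → Species.Str (S 2 ×ˢ S 3) E → Species.Str D₃* E
diagramOfPermutations w ((τ , τ²≡id) , (σ , σ³≡id)) = diagramOf w τσ , diagramOf-trivalent w τσ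
  where
  τσ : C₂*C₃-Action _
  τσ = record { τ = to τ ; σ = to σ ; τ-involutive = τ²≡id ; σ³≡id = σ³≡id }

D₃*≅S₂×S₃ : NatIso D₃* (S 2 ×ˢ S 3)
D₃*≅S₂×S₃ = record
  { fwd      = permutationsOf
  ; bwd      = diagramOfPermutations
  ; fwd-cong = λ _ D≅D′ → DiagIso.inv-eq D≅D′ , λ a → DiagIso.act-eq D≅D′ a 1ℤ
  ; bwd-cong = λ _ (τ≗τ′ , σ≗σ′) → inv-next⇒DiagIso τ≗τ′ σ≗σ′
  ; bwd-fwd  = λ _ _ → inv-next⇒DiagIso (λ _ → refl) (λ _ → refl)
  ; fwd-bwd  = λ _ _ → (λ _ → refl) , (λ _ → refl)
  ; natural  = λ _ _ _ _ → (λ _ → refl) , (λ _ → refl)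
  }

-- Words and connected components

data Letter : Set where
  ‵τ ‵σ : Letter

Word : Set
Word = List Letter

power : ℕ → Word → Word
power zero    ws = []
power (suc n) ws = ws ++ power n ws

module _ (τ σ : E → E) where

  letter : Letter → E → E
  letter ‵τ = τ
  letter ‵σ = σ

  run : Word → E → E
  run []       a = a
  run (l ∷ ws) a = run ws (letter l a)

  run-++ : ∀ u v a → run (u ++ v) a ≡ run v (run u a)
  run-++ []      v a = refl
  run-++ (l ∷ u) v a = run-++ u v (letter l a)

  run-power : ∀ {f} ws → (∀ a → run ws a ≡ f a) → ∀ n a → run (power n ws) a ≡ pow n f a
  run-power {f} ws run≗f zero    a = refl
  run-power {f} ws run≗f (suc n) a = begin
    run (ws ++ power n ws) a    ≡⟨ run-++ ws (power n ws) a ⟩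
    run (power n ws) (run ws a) ≡⟨ run-power ws run≗f n (run ws a) ⟩
    pow n f (run ws a)          ≡⟨ cong (pow n f) (run≗f a) ⟩
    pow n f (f a)               ≡⟨ pow-comm f n a ⟩
    f (pow n f a)               ∎
    where open ≡-Reasoning

  σ-iteration : ℤ → Word
  σ-iteration (+ n)    = power n (‵σ ∷ [])
  σ-iteration -[1+ n ] = power (suc n) (‵σ ∷ ‵σ ∷ [])

  run-σ-iteration : ∀ k a → run (σ-iteration k) a ≡ iterateℤ σ (σ ∘ σ) k a
  run-σ-iteration (+ n)    = run-power (‵σ ∷ []) (λ _ → refl) n
  run-σ-iteration -[1+ n ] = run-power (‵σ ∷ ‵σ ∷ []) (λ _ → refl) (suc n)

  Reachable : E → E → Set
  Reachable a b = ∃ λ ws → run ws a ≡ b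

  Reachable-trans : ∀ {a b c} → Reachable a b → Reachable b c → Reachable a c
  Reachable-trans {a} (u , refl) (v , refl) = u ++ v , run-++ u v a

run-natural : {τ σ : A → A} {τ′ σ′ : B → B} (h : A → B) →
              (∀ a → h (τ a) ≡ τ′ (h a)) → (∀ a → h (σ a) ≡ σ′ (h a)) →
              ∀ ws a → h (run τ σ ws a) ≡ run τ′ σ′ ws (h a)
run-natural h τ-comm σ-comm []        a = refl
run-natural h τ-comm σ-comm (‵τ ∷ ws) a = trans (run-natural h τ-comm σ-comm ws _) (cong (run _ _ ws) (τ-comm a))
run-natural h τ-comm σ-comm (‵σ ∷ ws) a = trans (run-natural h τ-comm σ-comm ws _) (cong (run _ _ ws) (σ-comm a))

Reachable-≗ : {τ σ τ′ σ′ : E → E} → τ ≗ τ′ → σ ≗ σ′ → ∀ {a b} → Reachable τ σ a b → Reachable τ′ σ′ a b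
Reachable-≗ τ≗τ′ σ≗σ′ {a} (ws , refl) = ws , sym (run-natural id τ≗τ′ σ≗σ′ ws a)

module _ (A : C₂*C₃-Action E) where
  open C₂*C₃-Action A

  private
    inverse : Word → Word
    inverse []        = []
    inverse (‵τ ∷ ws) = inverse ws ++ ‵τ ∷ []
    inverse (‵σ ∷ ws) = inverse ws ++ ‵σ ∷ ‵σ ∷ []

    run-inverse : ∀ ws a → run τ σ (inverse ws) (run τ σ ws a) ≡ a
    run-inverse []        a = refl
    run-inverse (‵τ ∷ ws) a = begin
      run τ σ (inverse ws ++ ‵τ ∷ []) (run τ σ ws (τ a))  ≡⟨ run-++ τ σ (inverse ws) (‵τ ∷ []) (run τ σ ws (τ a)) ⟩
      τ (run τ σ (inverse ws) (run τ σ ws (τ a)))        ≡⟨ cong τ (run-inverse ws (τ a)) ⟩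
      τ (τ a)                                            ≡⟨ τ-involutive a ⟩
      a                                                  ∎
      where open ≡-Reasoning
    run-inverse (‵σ ∷ ws) a = begin
      run τ σ (inverse ws ++ ‵σ ∷ ‵σ ∷ []) (run τ σ ws (σ a)) ≡⟨ run-++ τ σ (inverse ws) (‵σ ∷ ‵σ ∷ []) (run τ σ ws (σ a)) ⟩
      σ (σ (run τ σ (inverse ws) (run τ σ ws (σ a))))       ≡⟨ cong (σ ∘ σ) (run-inverse ws (σ a)) ⟩
      pow 3 σ a                                             ≡⟨ σ³≡id a ⟩
      a                                                     ∎
      where open ≡-Reasoning

  Reachable-sym : ∀ {a b} → Reachable τ σ a b → Reachable τ σ b a
  Reachable-sym {a} (ws , refl) = inverse ws , run-inverse ws a

module _ (D : Diagram E) where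
  open Diagram D

  same-vertex-or-Chain : ∀ ws a → let b = run inv (next D) ws a in s a ≡ s b ⊎ Chain D (s a) (s b)
  same-vertex-or-Chain []        a = inj₁ refl
  same-vertex-or-Chain (‵τ ∷ ws) a with same-vertex-or-Chain ws (inv a)
  ... | inj₁ sa⁻¹≡sb = inj₂ (one a refl (trans (sym (s-inv a)) sa⁻¹≡sb))
  ... | inj₂ chain   = inj₂ (cons a refl (subst (λ x → Chain D x (s (run inv (next D) ws (inv a)))) (s-inv a) chain))
  same-vertex-or-Chain (‵σ ∷ ws) a with same-vertex-or-Chain ws (next D a)
  ... | inj₁ sa′≡sb = inj₁ (trans (sym (s-next D a)) sa′≡sb)
  ... | inj₂ chain  = inj₂ (subst (λ x → Chain D x (s (run inv (next D) ws (next D a)))) (s-next D a) chain)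

  Reachable⇒Chain : ∀ {a b} → Reachable inv (next D) a b → s a ≢ s b → Chain D (s a) (s b)
  Reachable⇒Chain {a} (ws , refl) sa≢sb with same-vertex-or-Chain ws a
  ... | inj₁ sa≡sb = ⊥-elim (sa≢sb sa≡sb)
  ... | inj₂ chain = chain

  module _ (trivalent : Trivalent D) where
    private
      Reach = Reachable inv (next D)

    Reachable-in-star : ∀ {a b} → s a ≡ s b → Reach a b
    Reachable-in-star {a} {b} sa≡sb with star⊆orbit a b sa≡sb
    ... | k , a+k≡b = σ-iteration inv (next D) k , (begin
      run inv (next D) (σ-iteration inv (next D) k) a ≡⟨ run-σ-iteration inv (next D) k a ⟩
      iterateℤ (next D) (next D ∘ next D) k a         ≡⟨ sym (act≡iterateℤ D (period-three D trivalent) k a) ⟩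
      a +ᵃ k                                          ≡⟨ a+k≡b ⟩
      b                                               ∎)
      where open ≡-Reasoning

    private
      across : ∀ {a b} c → s a ≡ s c → Reach (inv c) b → Reach a b
      across c sa≡sc c⁻¹⇝b = Reachable-trans inv (next D) (Reachable-in-star sa≡sc)
                               (Reachable-trans inv (next D) (‵τ ∷ [] , refl) c⁻¹⇝b)

    Reachable-along-Chain : ∀ {x y a b} → Chain D x y → s a ≡ x → s b ≡ y → Reach a b
    Reachable-along-Chain (one c sc≡x tc≡y) sa≡x sb≡y =
      across c (trans sa≡x (sym sc≡x)) (Reachable-in-star (trans (s-inv c) (trans tc≡y (sym sb≡y))))
    Reachable-along-Chain (cons c sc≡x chain) sa≡x sb≡y =
      across c (trans sa≡x (sym sc≡x)) (Reachable-along-Chain chain (s-inv c) sb≡y)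

    Connected⇒Reachable : Connected D → ∀ a b → Reach a b
    Connected⇒Reachable connected a b with s a ≟ s b
    ... | yes sa≡sb = Reachable-in-star sa≡sb
    ... | no  sa≢sb = Reachable-along-Chain (connected (s a) (s b) sa≢sb) refl refl

module Components (w : Finite E) (A : C₂*C₃-Action E) where
  open C₂*C₃-Action A

  private
    n = proj₁ w

  Within : ℕ → E → E → Set
  Within zero    a b = a ≡ b
  Within (suc L) a b = a ≡ b ⊎ Within L (τ a) b ⊎ Within L (σ a) b

  within? : ∀ L → Decidable (Within L)
  within? zero    a b = ≟-finite w a b
  within? (suc L) a b = ≟-finite w a b ⊎-dec within? L (τ a) b ⊎-dec within? L (σ a) b

  Within⇒Reachable : ∀ L {a b} → Within L a b → Reachable τ σ a b
  Within⇒Reachable zero    a≡b                = [] , a≡b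
  Within⇒Reachable (suc L) (inj₁ a≡b)         = [] , a≡b
  Within⇒Reachable (suc L) (inj₂ (inj₁ τa⇝b)) = Reachable-trans τ σ (‵τ ∷ [] , refl) (Within⇒Reachable L τa⇝b)
  Within⇒Reachable (suc L) (inj₂ (inj₂ σa⇝b)) = Reachable-trans τ σ (‵σ ∷ [] , refl) (Within⇒Reachable L σa⇝b)

  Within-run : ∀ L ws a → length ws ≤ L → Within L a (run τ σ ws a)
  Within-run zero    []        a _        = refl
  Within-run (suc L) []        a _        = inj₁ refl
  Within-run (suc L) (‵τ ∷ ws) a (s≤s ≤L) = inj₂ (inj₁ (Within-run L ws (τ a) ≤L))
  Within-run (suc L) (‵σ ∷ ws) a (s≤s ≤L) = inj₂ (inj₂ (Within-run L ws (σ a) ≤L))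

  -- Two of the n + 1 shortest prefixes of ws end at the same element; cut out the loop between them.
  shortcut : ∀ ws a → n < length ws → ∃ λ ws′ → length ws′ < length ws × run τ σ ws′ a ≡ run τ σ ws a
  shortcut ws a n<|ws| with pigeonhole (ℕ.n<1+n n) (λ i → from (proj₂ w) (run τ σ (take (toℕ i) ws) a))
  ... | i′ , j′ , i<j , same-end = take i ws ++ drop j ws , shorter , loop-removed
    where
    i j : ℕ
    i = toℕ i′
    j = toℕ j′
    loop-removed : run τ σ (take i ws ++ drop j ws) a ≡ run τ σ ws a
    loop-removed = begin
      run τ σ (take i ws ++ drop j ws) a           ≡⟨ run-++ τ σ (take i ws) (drop j ws) a ⟩
      run τ σ (drop j ws) (run τ σ (take i ws) a)  ≡⟨ cong (run τ σ (drop j ws)) (from-injective (proj₂ w) same-end) ⟩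
      run τ σ (drop j ws) (run τ σ (take j ws) a)  ≡⟨ sym (run-++ τ σ (take j ws) (drop j ws) a) ⟩
      run τ σ (take j ws ++ drop j ws) a           ≡⟨ cong (λ ws → run τ σ ws a) (take++drop≡id j ws) ⟩
      run τ σ ws a                                 ∎
      where open ≡-Reasoning
    shorter : length (take i ws ++ drop j ws) < length ws
    shorter = begin-strict
      length (take i ws ++ drop j ws)          ≡⟨ length-++ (take i ws) ⟩
      length (take i ws) + length (drop j ws)  ≡⟨ cong₂ _+_ (length-take i ws) (length-drop j ws) ⟩
      i ℕ.⊓ length ws + (length ws ∸ j)        ≤⟨ ℕ.+-monoˡ-≤ _ (ℕ.m⊓n≤m i _) ⟩
      i + (length ws ∸ j)                      <⟨ ℕ.+-monoˡ-< _ i<j ⟩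
      j + (length ws ∸ j)                      ≡⟨ ℕ.m+[n∸m]≡n (ℕ.≤-trans (toℕ≤pred[n] j′) (ℕ.<⇒≤ n<|ws|)) ⟩
      length ws                                ∎
      where open ℕ.≤-Reasoning

  shorten : ∀ ws a → ∃ λ ws′ → length ws′ ≤ n × run τ σ ws′ a ≡ run τ σ ws a
  shorten []       a = [] , z≤n , refl
  shorten (l ∷ ws) a with shorten ws (letter τ σ l a)
  ... | ws′ , |ws′|≤n , same-end with length ws′ ℕ.<? n
  ...   | yes |ws′|<n = l ∷ ws′ , |ws′|<n , same-end
  ...   | no  |ws′|≮n with shortcut (l ∷ ws′) a (s≤s (ℕ.≮⇒≥ |ws′|≮n))
  ...     | ws″ , shorter , same-end′ =
    ws″ , ℕ.≤-pred (ℕ.≤-trans shorter (s≤s |ws′|≤n)) , trans same-end′ same-end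

  _~_ : E → E → Set
  _~_ = Within n

  Reachable⇒~ : ∀ {a b} → Reachable τ σ a b → a ~ b
  Reachable⇒~ {a} (ws , refl) with shorten ws a
  ... | ws′ , |ws′|≤n , same-end = subst (Within n a) same-end (Within-run n ws′ a |ws′|≤n)

  ~-isEquivalence : IsEquivalence _~_
  ~-isEquivalence = record
    { refl  = Reachable⇒~ ([] , refl)
    ; sym   = Reachable⇒~ ∘ Reachable-sym A ∘ Within⇒Reachable n
    ; trans = λ a~b b~c → Reachable⇒~ (Reachable-trans τ σ (Within⇒Reachable n a~b) (Within⇒Reachable n b~c))
    }

  abstract
    components : Quotient E _~_
    components = quotient w (within? n) ~-isEquivalence

  open Quotient components public
    renaming (size to #components; class to component; class-surjective to component-surjective)

  Reachable⇒component≡ : ∀ {a b} → Reachable τ σ a b → component a ≡ component b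
  Reachable⇒component≡ = ~⇒class≡ ∘ Reachable⇒~

  component≡⇒Reachable : ∀ {a b} → component a ≡ component b → Reachable τ σ a b
  component≡⇒Reachable = Within⇒Reachable n ∘ class≡⇒~

  module _ (i : Fin #components) where

    Component : Set
    Component = Fiber component i

    restriction : C₂*C₃-Action Component
    restriction = record
      { τ            = τᵢ
      ; σ            = σᵢ
      ; τ-involutive = λ u → Fiber-≡ (τ-involutive (proj₁ u))
      ; σ³≡id        = λ u → Fiber-≡ (trans (pow-natural {f = σᵢ} {g = σ} proj₁ (λ _ → refl) 3 u) (σ³≡id (proj₁ u)))
      }
      where
      τᵢ σᵢ : Component → Component
      τᵢ (a , a∈i) = τ a , trans (sym (Reachable⇒component≡ (‵τ ∷ [] , refl))) a∈i
      σᵢ (a , a∈i) = σ a , trans (sym (Reachable⇒component≡ (‵σ ∷ [] , refl))) a∈i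

    componentDiagram : Diagram Component
    componentDiagram = diagramOf (finite-Fiber w component i) restriction

    componentDiagram-trivalent : Trivalent componentDiagram
    componentDiagram-trivalent = diagramOf-trivalent (finite-Fiber w component i) restriction

    componentDiagram-transitive : ∀ u v → Reachable (Diagram.inv componentDiagram) (next componentDiagram) u v
    componentDiagram-transitive u v with component≡⇒Reachable (trans (proj₂ u) (sym (proj₂ v)))
    ... | ws , u⇝v = ws , Fiber-≡ (trans (run-natural proj₁ (λ _ → refl) (λ _ → refl) ws u) u⇝v)

    componentDiagram-connected : Connected componentDiagram
    componentDiagram-connected x y x≢y =
      subst₂ (Chain componentDiagram) su≡x sv≡y
        (Reachable⇒Chain componentDiagram (componentDiagram-transitive u v)
                                           (λ su≡sv → x≢y (trans (sym su≡x) (trans su≡sv sv≡y))))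
      where
      open Diagram componentDiagram
      u = proj₁ (no-isolated x)
      su≡x = proj₂ (no-isolated x)
      v = proj₁ (no-isolated y)
      sv≡y = proj₂ (no-isolated y)

-- Gluing and splitting

record ArcOperation : Set₁ where
  field
    apply           : {X : Set} → Diagram X → X → X
    transport-apply : {X Y : Set} (γ : X ↔ Y) (D : Diagram X) (y : Y) →
                      apply (transportD γ D) y ≡ to γ (apply D (from γ y))
    iso-apply       : {X : Set} {D D′ : Diagram X} → DiagIso D D′ → apply D ≗ apply D′

open ArcOperation

inverseArc nextArc : ArcOperation
inverseArc = record
  { apply = Diagram.inv ; transport-apply = λ _ _ _ → refl ; iso-apply = DiagIso.inv-eq }
nextArc = record
  { apply = next ; transport-apply = λ _ _ _ → refl ; iso-apply = λ D≅D′ a → DiagIso.act-eq D≅D′ a 1ℤ }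

module Glue (x : Partitioned D₃ E) where
  open Partitioned x

  diagram : (i : Fin k) → Diagram (Fiber block i)
  diagram i = proj₁ (struct i)

  glue : ArcOperation → E → E
  glue op a = proj₁ (apply op (diagram (block a)) (a , refl))

  glue-Fiber : ∀ op i (u : Fiber block i) → proj₁ (apply op (diagram i) u) ≡ glue op (proj₁ u)
  glue-Fiber op i (a , refl) = refl

  glue-pow : ∀ op n a → pow n (glue op) a ≡ proj₁ (pow n (apply op (diagram (block a))) (a , refl))
  glue-pow op n a = sym (pow-natural {g = glue op} proj₁ (glue-Fiber op (block a)) n (a , refl))

  action : C₂*C₃-Action E
  action = record
    { τ            = glue inverseArc
    ; σ            = glue nextArc
    ; τ-involutive = λ a → trans (glue-pow inverseArc 2 a) (cong proj₁ (Diagram.inv-inv (diagram (block a)) (a , refl)))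
    ; σ³≡id        = λ a → trans (glue-pow nextArc 3 a)
                               (cong proj₁ (period-three (diagram (block a)) (proj₁ (proj₂ (struct (block a)))) (a , refl)))
    }

  private
    Reach = Reachable (glue inverseArc) (glue nextArc)

  Reachable⇒block≡ : ∀ {a b} → Reach a b → block a ≡ block b
  Reachable⇒block≡ {a} (ws , refl) = sym (block-run ws a)
    where
    block-run : ∀ ws a → block (run (glue inverseArc) (glue nextArc) ws a) ≡ block a
    block-run []        a = refl
    block-run (‵τ ∷ ws) a = trans (block-run ws _) (proj₂ (Diagram.inv (diagram (block a)) (a , refl)))
    block-run (‵σ ∷ ws) a = trans (block-run ws _) (proj₂ (next (diagram (block a)) (a , refl)))

  block≡⇒Reachable : ∀ {a b} → block a ≡ block b → Reach a b
  block≡⇒Reachable {a} {b} a∈j with Connected⇒Reachable (diagram j) trivalent connected (a , a∈j) (b , refl)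
    where
    j = block b
    trivalent = proj₁ (proj₂ (struct j))
    connected = proj₂ (proj₂ (struct j))
  ... | ws , a⇝b = ws , trans (sym (run-natural proj₁ (glue-Fiber inverseArc _) (glue-Fiber nextArc _) ws (a , a∈j)))
                             (cong proj₁ a⇝b)

open Glue using (glue; glue-Fiber)

module _ {x y : Partitioned D₃ E} where
  private
    module X = Partitioned x
    module Y = Partitioned y

  glue-cong : EnsEq D₃ x y → ∀ op a → glue x op a ≡ glue y op a
  glue-cong x≈y op a = begin
    glue x op a                                       ≡⟨ cong (proj₁ ∘ apply op Dᵢ) (sym (strictlyInverseʳ γ (a , refl))) ⟩
    proj₁ (apply op Dᵢ (from γ u))                    ≡⟨ sym (γ-proj₁ _) ⟩
    proj₁ (to γ (apply op Dᵢ (from γ u)))             ≡⟨ cong proj₁ (sym (transport-apply op γ Dᵢ u)) ⟩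
    proj₁ (apply op (transportD γ Dᵢ) u)              ≡⟨ cong proj₁ (iso-apply op γDᵢ≅Dⱼ u) ⟩
    proj₁ (apply op (Glue.diagram y (to π i)) u)      ≡⟨ glue-Fiber y op _ u ⟩
    glue y op (proj₁ u)                               ≡⟨ cong (glue y op) (γ-proj₁ (a , refl)) ⟩
    glue y op a                                       ∎
    where
    open ≡-Reasoning
    open EnsEq x≈y
    i = X.block a
    Dᵢ = Glue.diagram x i
    γ = proj₁ (π-struct i)
    γ-proj₁ = proj₁ (proj₂ (π-struct i))
    γDᵢ≅Dⱼ = proj₂ (proj₂ (π-struct i))
    u = to γ (a , refl)

  EnsEq-from-glue : (∀ {a b} → X.block a ≡ X.block b → Y.block a ≡ Y.block b) →
                    (∀ {a b} → Y.block a ≡ Y.block b → X.block a ≡ X.block b) →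
                    glue x inverseArc ≗ glue y inverseArc → glue x nextArc ≗ glue y nextArc → EnsEq D₃ x y
  EnsEq-from-glue x⇒y y⇒x inv≗ next≗ = record
    { π        = labels-↔
    ; π-block  = labels-↔-commutes
    ; π-struct = λ i → fibers-↔ i , (λ _ → refl) ,
                       inv-next⇒DiagIso (transported inverseArc inv≗ i) (transported nextArc next≗ i)
    }
    where
    open SameKernel X.nonempty Y.nonempty x⇒y y⇒x
    transported : ∀ op → glue x op ≗ glue y op → ∀ i u →
                  apply op (transportD (fibers-↔ i) (Glue.diagram x i)) u ≡ apply op (Glue.diagram y (to labels-↔ i)) u
    transported op glue≗ i u = Fiber-≡ (begin
      proj₁ (apply op (transportD (fibers-↔ i) (Glue.diagram x i)) u)  ≡⟨ cong proj₁ (transport-apply op (fibers-↔ i) _ u) ⟩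
      proj₁ (apply op (Glue.diagram x i) (from (fibers-↔ i) u))         ≡⟨ glue-Fiber x op i _ ⟩
      glue x op (proj₁ u)                                               ≡⟨ glue≗ (proj₁ u) ⟩
      glue y op (proj₁ u)                                               ≡⟨ sym (glue-Fiber y op _ u) ⟩
      proj₁ (apply op (Glue.diagram y (to labels-↔ i)) u)               ∎)
      where open ≡-Reasoning

gluedDiagram : Finite E → Species.Str (Ens D₃) E → Species.Str D₃* E
gluedDiagram w x = diagramOf w (Glue.action x) , diagramOf-trivalent w (Glue.action x)

componentsOf : Finite E → Species.Str D₃* E → Species.Str (Ens D₃) E
componentsOf w (D , trivalent) = record
  { k        = #components
  ; block    = component
  ; nonempty = component-surjective
  ; struct   = λ i → componentDiagram i , componentDiagram-trivalent i , componentDiagram-connected i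
  }
  where open Components w (actionOf D trivalent)

gluedDiagram-natural : (w : Finite E) (w′ : Finite B) (β : E ↔ B) (x : Partitioned D₃ E) →
                       DiagIso (proj₁ (gluedDiagram w′ (transportEns D₃ β x))) (transportD β (proj₁ (gluedDiagram w x)))
gluedDiagram-natural w w′ β x =
  inv-next⇒DiagIso (λ a → cong (to β) (glue-Fiber x inverseArc _ (arc a))) (λ a → cong (to β) (glue-Fiber x nextArc _ (arc a)))
  where
  open Partitioned x
  arc : ∀ a → Fiber block (block (from β a))
  arc a = from (Fiber-↔ β block (block (from β a))) (a , refl)

componentsOf-cong : (w : Finite E) {y y′ : Species.Str D₃* E} → DiagIso (proj₁ y) (proj₁ y′) →
                    EnsEq D₃ (componentsOf w y) (componentsOf w y′)
componentsOf-cong w {D , t} {D′ , t′} D≅D′ =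
  EnsEq-from-glue (C′.Reachable⇒component≡ ∘ Reachable-≗ inv≗ next≗ ∘ C.component≡⇒Reachable)
                  (C.Reachable⇒component≡ ∘ Reachable-≗ (sym ∘ inv≗) (sym ∘ next≗) ∘ C′.component≡⇒Reachable)
                  inv≗ next≗
  where
  module C  = Components w (actionOf D t)
  module C′ = Components w (actionOf D′ t′)
  inv≗ : Diagram.inv D ≗ Diagram.inv D′
  inv≗ = DiagIso.inv-eq D≅D′
  next≗ : next D ≗ next D′
  next≗ a = DiagIso.act-eq D≅D′ a 1ℤ

componentsOf-gluedDiagram : (w : Finite E) (x : Partitioned D₃ E) → EnsEq D₃ (componentsOf w (gluedDiagram w x)) x
componentsOf-gluedDiagram w x =
  EnsEq-from-glue (Glue.Reachable⇒block≡ x ∘ C.component≡⇒Reachable) (C.Reachable⇒component≡ ∘ Glue.block≡⇒Reachable x)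
                  (λ _ → refl) (λ _ → refl)
  where module C = Components w (actionOf (proj₁ (gluedDiagram w x)) (proj₂ (gluedDiagram w x)))

Ens-D₃≅D₃* : NatIso (Ens D₃) D₃*
Ens-D₃≅D₃* = record
  { fwd      = gluedDiagram
  ; bwd      = componentsOf
  ; fwd-cong = λ _ x≈y → inv-next⇒DiagIso (glue-cong x≈y inverseArc) (glue-cong x≈y nextArc)
  ; bwd-cong = componentsOf-cong
  ; bwd-fwd  = componentsOf-gluedDiagram
  ; fwd-bwd  = λ _ _ → inv-next⇒DiagIso (λ _ → refl) (λ _ → refl)
  ; natural  = gluedDiagram-natural
  }

mainTheorem11 : NatIso (Ens D₃) D₃* × NatIso D₃* (S 2 ×ˢ S 3)
mainTheorem11 = Ens-D₃≅D₃* , D₃*≅S₂×S₃
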